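{- Let $n\ge1$, $p$ a prime, $R,S\subset E_n$, and let $\mathcal{C}\subset\mathbb{Z}^n$ be an admissible $S$-adapted $p$-cone. Then $\mathbb{K}(\mathcal{C})=\mathbb{K}_S$.
   Context: $E_n=\{1,\dots,n\}$, indices mod $n$; $e_i$ standard basis; $\delta_T^{(m)}=-1$ if $m\in T$, $1$ otherwise; $F^{(d)}_T(x)=\sum_{j=0}^{n-1}p^j\delta_T^{(d+j)}x_{d+j}$. An $S$-adapted $p$-cone is $\{x\in\mathbb{Z}^n:F^{(s)}_{T^{(s)}}(x)\le0\ \forall s\in S\}$ for a family $(T^{(s)})_{s\in S}$; it is admissible if each $T^{(s)}$ satisfies: for every $i\in E_n$ with $i+1\notin S$, exactly one of $i,i+1$ lies in $T^{(s)}$ if $i\notin R$, both or neither if $i\in R$. For a cone $\mathcal{C}$, $\mathbb{K}(\mathcal{C})=\{\lambda\in\mathcal{C}:-\lambda\in\mathcal{C}\}$. With $\mathsf{ha}^{(i)}_{R,S}=-\delta_S^{(i)}e_i-p\delta_R^{(i-1)}e_{i-1}$, $\mathbb{K}_S=\{x\in\mathbb{Z}^n: mx\in\sum_{i\notin S}\mathbb{Z}\,\mathsf{ha}^{(i)}_{R,S}\text{ for some } m\ge1\}$. -}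

module Defs where

open import Data.Nat as ℕ using (ℕ; zero; suc; NonZero)
open import Data.Nat.DivMod using (_mod_)
open import Data.Integer as ℤ using (ℤ; +_; -_; _+_; _*_; _≤_; 0ℤ; 1ℤ; -1ℤ)
open import Data.Fin as Fin using (Fin; toℕ)
open import Data.Fin.Subset using (Subset; _∈_; _∉_)
open import Data.Fin.Subset.Properties using (_∈?_)
open import Data.Product using (_×_; Σ; ∃-syntax)
open import Data.Sum using (_⊎_)
open import Relation.Nullary using (yes; no)
open import Relation.Binary.PropositionalEquality using (_≡_)

-- Indices: E_n = {1,…,n} is modelled by Fin n = {0,…,n-1} (shift by one);
-- all index arithmetic is modulo n.

shift : {n : ℕ} .{{_ : NonZero n}} → Fin n → ℕ → Fin n
shift {n} i j = (toℕ i ℕ.+ j) mod n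

next : {n : ℕ} .{{_ : NonZero n}} → Fin n → Fin n
next i = shift i 1

prev : {n : ℕ} .{{_ : NonZero n}} → Fin n → Fin n
prev {n} i = shift i (n ℕ.∸ 1)

δ : {n : ℕ} → Subset n → Fin n → ℤ
δ T m with m ∈? T
... | yes _ = -1ℤ
... | no  _ = 1ℤ

Σ< : ℕ → (ℕ → ℤ) → ℤ
Σ< zero    f = 0ℤ
Σ< (suc k) f = Σ< k f + f k

ΣFin : {n : ℕ} → (Fin n → ℤ) → ℤ
ΣFin {zero}  f = 0ℤ
ΣFin {suc n} f = f Fin.zero + ΣFin (λ i → f (Fin.suc i))

F : {n : ℕ} .{{_ : NonZero n}} → (p : ℕ) → Fin n → Subset n → (Fin n → ℤ) → ℤ
F {n} p d T x = Σ< n (λ j → (+ (p ℕ.^ j)) * (δ T (shift d j) * x (shift d j)))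

-- The S-adapted p-cone of a family (T^{(s)})_{s∈S}
-- (the family is given as a function on all of Fin n; only values at s ∈ S matter)
pCone : {n : ℕ} .{{_ : NonZero n}} → (p : ℕ) → (S : Subset n) → (T : Fin n → Subset n)
      → (Fin n → ℤ) → Set
pCone p S T x = ∀ s → s ∈ S → F p s (T s) x ≤ 0ℤ

AdmissibleSet : {n : ℕ} .{{_ : NonZero n}} → (R S T : Subset n) → Set
AdmissibleSet R S T =
  ∀ i → next i ∉ S →
    (i ∉ R → ((i ∈ T × next i ∉ T) ⊎ (i ∉ T × next i ∈ T)))
  × (i ∈ R → ((i ∈ T × next i ∈ T) ⊎ (i ∉ T × next i ∉ T)))

Admissible : {n : ℕ} .{{_ : NonZero n}} → (R S : Subset n) → (T : Fin n → Subset n) → Set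
Admissible R S T = ∀ s → s ∈ S → AdmissibleSet R S (T s)

𝕂 : {n : ℕ} → ((Fin n → ℤ) → Set) → (Fin n → ℤ) → Set
𝕂 C x = C x × C (λ k → - x k)

e : {n : ℕ} → Fin n → Fin n → ℤ
e i k with i Fin.≟ k
... | yes _ = 1ℤ
... | no  _ = 0ℤ

ha : {n : ℕ} .{{_ : NonZero n}} → (p : ℕ) → (R S : Subset n) → Fin n → Fin n → ℤ
ha p R S i k = - (δ S i * e i k) + - ((+ p) * (δ R (prev i) * e (prev i) k))

-- 𝕂_S = {x : m x ∈ Σ_{i∉S} ℤ ha^{(i)} for some m ≥ 1}
-- (an element of the ℤ-span of {ha^{(i)} : i ∉ S} is written with integer
--  coefficients c indexed by Fin n that vanish on S)
𝕂S : {n : ℕ} .{{_ : NonZero n}} → (p : ℕ) → (R S : Subset n) → (Fin n → ℤ) → Set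
𝕂S {n} p R S x =
  Σ ℕ λ m → (1 ℕ.≤ m) × (Σ (Fin n → ℤ) λ c → (∀ i → i ∈ S → c i ≡ 0ℤ)
     × (∀ k → (+ m) * x k ≡ ΣFin (λ i → c i * ha p R S i k)))

{-# OPTIONS --safe #-}

-- For s ∈ S and admissible T⁽ˢ⁾, the form F⁽ˢ⁾ kills every combination of the vectors ha⁽ⁱ⁾
-- with i ∉ S: admissibility makes the sum telescope. Since 𝕂(𝒞) is the common kernel of
-- the forms F⁽ˢ⁾, this gives 𝕂_S ⊆ 𝕂(𝒞). Conversely, off S the coordinates of Σ cᵢ ha⁽ⁱ⁾
-- are −(1 + pN) c for the weighted cyclic shift (N c)ₖ = δ_R(k) c_{k+1} (cut off at S), and
-- a truncated geometric series in −pN solves them up to an error (−pN)ⁿ. If S ≠ ∅ the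
-- error vanishes and m = 1: the residual r = x − Σ cᵢ ha⁽ⁱ⁾ is supported on S and killed
-- by every F⁽ᵗ⁾, and F⁽ᵗ⁾(r) = ±rₜ + p(…) shows p ∣ r with a quotient of the same kind,
-- so r is divisible by every power of p, hence r = 0. If S = ∅ the error is diagonal with
-- entries ±pⁿ, and squaring gives m = p²ⁿ − 1.
module Submission where

open import Defs
open import Data.Nat as ℕ using (ℕ; zero; suc; NonZero; z≤n; s≤s; _%_)
import Data.Nat.Properties as ℕ
open import Data.Nat.DivMod using (m%n<n; %-distribˡ-+; m%n%n≡m%n; [m+n]%n≡m%n; m<n⇒m%n≡m)
import Data.Nat.Divisibility as ℕ
open import Data.Nat.Primality using (Prime; prime⇒nonTrivial)
open import Data.Integer as ℤ using (ℤ; +_; -_; +[1+_]; -[1+_]; _+_; _-_; _*_; 0ℤ; 1ℤ; -1ℤ)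
import Data.Integer.Properties as ℤ
open import Data.Integer.Divisibility as ℤ∣ using (_∣_)
open import Data.Integer.Tactic.RingSolver using (solve-∀)
open import Data.Fin as Fin using (Fin; toℕ)
import Data.Fin.Properties as Fin
open import Data.Fin.Subset using (Subset; _∈_; _∉_)
open import Data.Fin.Subset.Properties using (_∈?_; nonempty?)
open import Data.Product using (_×_; _,_; proj₁; proj₂; ∃-syntax)
open import Data.Sum using (inj₁; inj₂)
open import Relation.Nullary using (Dec; yes; no; contradiction)
open import Relation.Binary.PropositionalEquality
open import Function using (_∘_)

Σ<-cong : ∀ k {f g : ℕ → ℤ} → (∀ j → f j ≡ g j) → Σ< k f ≡ Σ< k g
Σ<-cong zero    f≗g = refl
Σ<-cong (suc k) f≗g = cong₂ _+_ (Σ<-cong k f≗g) (f≗g k)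

Σ<-distrib-+ : ∀ k (f g : ℕ → ℤ) → Σ< k (λ j → f j + g j) ≡ Σ< k f + Σ< k g
Σ<-distrib-+ zero    f g = refl
Σ<-distrib-+ (suc k) f g =
  trans (cong (_+ (f k + g k)) (Σ<-distrib-+ k f g)) (interchange (Σ< k f) (Σ< k g) (f k) (g k))
  where
  interchange : ∀ a b c d → (a + b) + (c + d) ≡ (a + c) + (b + d)
  interchange = solve-∀

Σ<-neg : ∀ k (f : ℕ → ℤ) → Σ< k (λ j → - f j) ≡ - Σ< k f
Σ<-neg zero    f = refl
Σ<-neg (suc k) f = trans (cong (_+ - f k) (Σ<-neg k f)) (sym (ℤ.neg-distrib-+ (Σ< k f) (f k)))

Σ<-zero : ∀ k {f : ℕ → ℤ} → (∀ j → f j ≡ 0ℤ) → Σ< k f ≡ 0ℤ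
Σ<-zero zero    f≗0 = refl
Σ<-zero (suc k) f≗0 = cong₂ _+_ (Σ<-zero k f≗0) (f≗0 k)

*-distribˡ-Σ< : ∀ k a (f : ℕ → ℤ) → a * Σ< k f ≡ Σ< k (λ j → a * f j)
*-distribˡ-Σ< zero    a f = ℤ.*-zeroʳ a
*-distribˡ-Σ< (suc k) a f =
  trans (ℤ.*-distribˡ-+ a (Σ< k f) (f k)) (cong (_+ a * f k) (*-distribˡ-Σ< k a f))

Σ<-telescope : ∀ k (f : ℕ → ℤ) → Σ< k (λ j → f (suc j) - f j) ≡ f k - f 0
Σ<-telescope zero    f = sym (ℤ.+-inverseʳ (f 0))
Σ<-telescope (suc k) f =
  trans (cong (_+ (f (suc k) - f k)) (Σ<-telescope k f)) (collapse (f k) (f 0) (f (suc k)))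
  where
  collapse : ∀ a b c → (a - b) + (c - a) ≡ c - b
  collapse = solve-∀

Σ<-split-first : ∀ k (f : ℕ → ℤ) → Σ< (suc k) f ≡ f 0 + Σ< k (λ j → f (suc j))
Σ<-split-first zero    f = trans (ℤ.+-identityˡ (f 0)) (sym (ℤ.+-identityʳ (f 0)))
Σ<-split-first (suc k) f =
  trans (cong (_+ f (suc k)) (Σ<-split-first k f)) (ℤ.+-assoc (f 0) _ (f (suc k)))

ΣFin-cong : ∀ {m} {f g : Fin m → ℤ} → (∀ i → f i ≡ g i) → ΣFin f ≡ ΣFin g
ΣFin-cong {zero}  f≗g = refl
ΣFin-cong {suc m} f≗g = cong₂ _+_ (f≗g Fin.zero) (ΣFin-cong (f≗g ∘ Fin.suc))

ΣFin-distrib-+ : ∀ {m} (f g : Fin m → ℤ) → ΣFin (λ i → f i + g i) ≡ ΣFin f + ΣFin g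
ΣFin-distrib-+ {zero}  f g = refl
ΣFin-distrib-+ {suc m} f g =
  trans (cong (_+_ (f Fin.zero + g Fin.zero)) (ΣFin-distrib-+ (f ∘ Fin.suc) (g ∘ Fin.suc)))
        (interchange (f Fin.zero) (g Fin.zero) (ΣFin (f ∘ Fin.suc)) (ΣFin (g ∘ Fin.suc)))
  where
  interchange : ∀ a b c d → (a + b) + (c + d) ≡ (a + c) + (b + d)
  interchange = solve-∀

ΣFin-zero : ∀ {m} {f : Fin m → ℤ} → (∀ i → f i ≡ 0ℤ) → ΣFin f ≡ 0ℤ
ΣFin-zero {zero}  f≗0 = refl
ΣFin-zero {suc m} f≗0 = cong₂ _+_ (f≗0 Fin.zero) (ΣFin-zero (f≗0 ∘ Fin.suc))

ΣFin-single : ∀ {m} (f : Fin m → ℤ) k → (∀ i → i ≢ k → f i ≡ 0ℤ) → ΣFin f ≡ f k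
ΣFin-single {suc m} f Fin.zero    f≗0 =
  trans (cong (_+_ (f Fin.zero)) (ΣFin-zero (λ i → f≗0 (Fin.suc i) λ ())))
        (ℤ.+-identityʳ (f Fin.zero))
ΣFin-single {suc m} f (Fin.suc k) f≗0 =
  trans (cong₂ _+_ (f≗0 Fin.zero λ ())
                   (ΣFin-single (f ∘ Fin.suc) k (λ i i≢k → f≗0 (Fin.suc i) (i≢k ∘ Fin.suc-injective))))
        (ℤ.+-identityˡ (f (Fin.suc k)))

e-on : ∀ {m} {i k : Fin m} → i ≡ k → e i k ≡ 1ℤ
e-on {i = i} {k} i≡k with i Fin.≟ k
... | yes _   = refl
... | no  i≢k = contradiction i≡k i≢k

e-off : ∀ {m} {i k : Fin m} → i ≢ k → e i k ≡ 0ℤ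
e-off {i = i} {k} i≢k with i Fin.≟ k
... | yes i≡k = contradiction i≡k i≢k
... | no  _   = refl

ΣFin-select : ∀ {m} (g : Fin m → ℤ) k → ΣFin (λ i → g i * e i k) ≡ g k
ΣFin-select g k =
  trans (ΣFin-single (λ i → g i * e i k) k (λ i i≢k → trans (cong (g i *_) (e-off i≢k)) (ℤ.*-zeroʳ (g i))))
        (trans (cong (g k *_) (e-on refl)) (ℤ.*-identityʳ (g k)))

δ-∈ : ∀ {m} {T : Subset m} {k} → k ∈ T → δ T k ≡ -1ℤ
δ-∈ {T = T} {k} k∈T with k ∈? T
... | yes _   = refl
... | no  k∉T = contradiction k∈T k∉T

δ-∉ : ∀ {m} {T : Subset m} {k} → k ∉ T → δ T k ≡ 1ℤ
δ-∉ {T = T} {k} k∉T with k ∈? T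
... | yes k∈T = contradiction k∈T k∉T
... | no  _   = refl

δ*δ≡1 : ∀ {m} (T : Subset m) k → δ T k * δ T k ≡ 1ℤ
δ*δ≡1 T k with k ∈? T
... | yes _ = refl
... | no  _ = refl

module _ {n : ℕ} .{{_ : NonZero n}} where

  toℕ-shift : ∀ (k : Fin n) j → toℕ (shift k j) ≡ (toℕ k ℕ.+ j) % n
  toℕ-shift k j = Fin.toℕ-fromℕ< (m%n<n (toℕ k ℕ.+ j) n)

  %-absorbˡ : ∀ a b → ((a % n) ℕ.+ b) % n ≡ (a ℕ.+ b) % n
  %-absorbˡ a b = begin
    ((a % n) ℕ.+ b) % n            ≡⟨ %-distribˡ-+ (a % n) b n ⟩
    ((a % n % n) ℕ.+ (b % n)) % n  ≡⟨ cong (λ z → (z ℕ.+ b % n) % n) (m%n%n≡m%n a n) ⟩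
    ((a % n) ℕ.+ (b % n)) % n      ≡⟨ %-distribˡ-+ a b n ⟨
    (a ℕ.+ b) % n                  ∎
    where open ≡-Reasoning

  shift-shift : ∀ (k : Fin n) i j → shift (shift k i) j ≡ shift k (i ℕ.+ j)
  shift-shift k i j = Fin.toℕ-injective (begin
    toℕ (shift (shift k i) j)        ≡⟨ toℕ-shift (shift k i) j ⟩
    (toℕ (shift k i) ℕ.+ j) % n      ≡⟨ cong (λ z → (z ℕ.+ j) % n) (toℕ-shift k i) ⟩
    ((toℕ k ℕ.+ i) % n ℕ.+ j) % n    ≡⟨ %-absorbˡ (toℕ k ℕ.+ i) j ⟩
    (toℕ k ℕ.+ i ℕ.+ j) % n          ≡⟨ cong (_% n) (ℕ.+-assoc (toℕ k) i j) ⟩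
    (toℕ k ℕ.+ (i ℕ.+ j)) % n        ≡⟨ toℕ-shift k (i ℕ.+ j) ⟨
    toℕ (shift k (i ℕ.+ j))          ∎)
    where open ≡-Reasoning

  shift-zero : ∀ (k : Fin n) → shift k 0 ≡ k
  shift-zero k = Fin.toℕ-injective (begin
    toℕ (shift k 0)      ≡⟨ toℕ-shift k 0 ⟩
    (toℕ k ℕ.+ 0) % n    ≡⟨ cong (_% n) (ℕ.+-identityʳ (toℕ k)) ⟩
    toℕ k % n            ≡⟨ m<n⇒m%n≡m (Fin.toℕ<n k) ⟩
    toℕ k                ∎)
    where open ≡-Reasoning

  shift-n : ∀ (k : Fin n) → shift k n ≡ k
  shift-n k = Fin.toℕ-injective (begin
    toℕ (shift k n)      ≡⟨ toℕ-shift k n ⟩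
    (toℕ k ℕ.+ n) % n    ≡⟨ [m+n]%n≡m%n (toℕ k) n ⟩
    toℕ k % n            ≡⟨ m<n⇒m%n≡m (Fin.toℕ<n k) ⟩
    toℕ k                ∎)
    where open ≡-Reasoning

  next-shift : ∀ (k : Fin n) j → next (shift k j) ≡ shift k (suc j)
  next-shift k j = trans (shift-shift k j 1) (cong (shift k) (ℕ.+-comm j 1))

  shift-next : ∀ (k : Fin n) j → shift (next k) j ≡ shift k (suc j)
  shift-next k = shift-shift k 1

  prev-next : ∀ (k : Fin n) → prev (next k) ≡ k
  prev-next k = trans (shift-shift k 1 (n ℕ.∸ 1)) (trans (cong (shift k) (ℕ.suc-pred n)) (shift-n k))

  next-prev : ∀ (k : Fin n) → next (prev k) ≡ k
  next-prev k = trans (shift-shift k (n ℕ.∸ 1) 1)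
                      (trans (cong (shift k) (ℕ.+-comm (n ℕ.∸ 1) 1))
                             (trans (cong (shift k) (ℕ.suc-pred n)) (shift-n k)))

  shift-reaches : ∀ (k s : Fin n) → ∃[ i ] i ℕ.< n × shift k i ≡ s
  shift-reaches k s = i , m%n<n _ n , Fin.toℕ-injective (begin
    toℕ (shift k i)                                ≡⟨ toℕ-shift k i ⟩
    (toℕ k ℕ.+ i) % n                              ≡⟨ cong (_% n) (ℕ.+-comm (toℕ k) i) ⟩
    (i ℕ.+ toℕ k) % n                              ≡⟨ %-absorbˡ d (toℕ k) ⟩
    (d ℕ.+ toℕ k) % n                              ≡⟨ cong (_% n) (ℕ.+-assoc (toℕ s) _ (toℕ k)) ⟩
    (toℕ s ℕ.+ (n ℕ.∸ toℕ k ℕ.+ toℕ k)) % n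
      ≡⟨ cong (λ z → (toℕ s ℕ.+ z) % n) (ℕ.m∸n+n≡m (ℕ.<⇒≤ (Fin.toℕ<n k))) ⟩
    (toℕ s ℕ.+ n) % n                              ≡⟨ [m+n]%n≡m%n (toℕ s) n ⟩
    toℕ s % n                                      ≡⟨ m<n⇒m%n≡m (Fin.toℕ<n s) ⟩
    toℕ s                                          ∎)
    where
    open ≡-Reasoning
    d i : ℕ
    d = toℕ s ℕ.+ (n ℕ.∸ toℕ k)
    i = d % n

  e-prev : ∀ (i k : Fin n) → e (prev i) k ≡ e i (next k)
  e-prev i k = by-cases (prev i Fin.≟ k)
    where
    by-cases : Dec (prev i ≡ k) → e (prev i) k ≡ e i (next k)
    by-cases (yes i′≡k) = trans (e-on i′≡k) (sym (e-on (trans (sym (next-prev i)) (cong next i′≡k))))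
    by-cases (no  i′≢k) = trans (e-off i′≢k)
                                (sym (e-off (λ i≡k′ → i′≢k (trans (cong prev i≡k′) (prev-next k)))))

n<p^n : ∀ {p} → 1 ℕ.< p → ∀ m → m ℕ.< p ℕ.^ m
n<p^n 1<p zero        = ℕ.z<s
n<p^n {p} 1<p (suc m) = begin
  suc (suc m)          ≡⟨ ℕ.+-comm 1 (suc m) ⟩
  suc m ℕ.+ 1          ≤⟨ ℕ.+-mono-≤ ih (ℕ.≤-trans (s≤s z≤n) ih) ⟩
  p ℕ.^ m ℕ.+ p ℕ.^ m  ≡⟨ cong (p ℕ.^ m ℕ.+_) (ℕ.+-identityʳ (p ℕ.^ m)) ⟨
  2 ℕ.* p ℕ.^ m        ≤⟨ ℕ.*-monoˡ-≤ (p ℕ.^ m) 1<p ⟩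
  p ℕ.* p ℕ.^ m        ∎
  where
  open ℕ.≤-Reasoning
  ih : m ℕ.< p ℕ.^ m
  ih = n<p^n 1<p m

divisible-by-all-powers⇒0 : ∀ {p} → 1 ℕ.< p → ∀ z → (∀ K → + (p ℕ.^ K) ∣ z) → z ≡ 0ℤ
divisible-by-all-powers⇒0 1<p (+ zero)   _     = refl
divisible-by-all-powers⇒0 1<p +[1+ m ]   p^K∣z =
  contradiction (ℕ.∣⇒≤ (p^K∣z (suc m))) (ℕ.<⇒≱ (n<p^n 1<p (suc m)))
divisible-by-all-powers⇒0 1<p -[1+ m ]   p^K∣z =
  contradiction (ℕ.∣⇒≤ (p^K∣z (suc m))) (ℕ.<⇒≱ (n<p^n 1<p (suc m)))

[-p]^j*[-p]^j≡p^j*p^j : ∀ p j → (- + p) ℤ.^ j * (- + p) ℤ.^ j ≡ + (p ℕ.^ j ℕ.* p ℕ.^ j)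
[-p]^j*[-p]^j≡p^j*p^j p zero    = refl
[-p]^j*[-p]^j≡p^j*p^j p (suc j) = begin
  (- P * A) * (- P * A)        ≡⟨ regroup P A ⟩
  (P * P) * (A * A)            ≡⟨ cong ((P * P) *_) ([-p]^j*[-p]^j≡p^j*p^j p j) ⟩
  (P * P) * + (q ℕ.* q)        ≡⟨ cong ((P * P) *_) (ℤ.pos-* q q) ⟩
  (P * P) * (+ q * + q)        ≡⟨ interchange P (+ q) ⟩
  (P * + q) * (P * + q)        ≡⟨ cong₂ _*_ (ℤ.pos-* p q) (ℤ.pos-* p q) ⟨
  + (p ℕ.* q) * + (p ℕ.* q)    ≡⟨ ℤ.pos-* (p ℕ.* q) (p ℕ.* q) ⟨
  + (p ℕ.* q ℕ.* (p ℕ.* q))    ∎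
  where
  open ≡-Reasoning
  P = + p
  A = (- + p) ℤ.^ j
  q = p ℕ.^ j
  regroup : ∀ P A → (- P * A) * (- P * A) ≡ (P * P) * (A * A)
  regroup = solve-∀
  interchange : ∀ P Q → (P * P) * (Q * Q) ≡ (P * Q) * (P * Q)
  interchange = solve-∀

-- The forms F⁽ˢ⁾ and the vectors ha⁽ⁱ⁾

module Cones {n : ℕ} .{{_ : NonZero n}} (p : ℕ) (R S : Subset n) where

  haSum : (Fin n → ℤ) → Fin n → ℤ
  haSum c k = - (δ S k * c k) + - (+ p * (δ R k * c (next k)))

  ΣFin-ha : ∀ (c : Fin n → ℤ) k → ΣFin (λ i → c i * ha p R S i k) ≡ haSum c k
  ΣFin-ha c k = begin
    ΣFin (λ i → c i * ha p R S i k)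
      ≡⟨ ΣFin-cong (λ i → trans (expand (c i) (δ S i) (e i k) (+ p) (δ R (prev i)) (e (prev i) k))
                                (cong (λ z → g₁ i * e i k + g₂ i * z) (e-prev i k))) ⟩
    ΣFin (λ i → g₁ i * e i k + g₂ i * e i (next k))
      ≡⟨ ΣFin-distrib-+ (λ i → g₁ i * e i k) (λ i → g₂ i * e i (next k)) ⟩
    ΣFin (λ i → g₁ i * e i k) + ΣFin (λ i → g₂ i * e i (next k))
      ≡⟨ cong₂ _+_ (ΣFin-select g₁ k) (ΣFin-select g₂ (next k)) ⟩
    g₁ k + g₂ (next k)
      ≡⟨ cong (λ z → g₁ k + - (+ p * (δ R z * c (next k)))) (prev-next k) ⟩
    haSum c k ∎
    where
    open ≡-Reasoning
    g₁ g₂ : Fin n → ℤ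
    g₁ i = - (δ S i * c i)
    g₂ i = - (+ p * (δ R (prev i) * c i))
    expand : ∀ c dS e₁ P dR e₂ →
             c * (- (dS * e₁) + - (P * (dR * e₂))) ≡ - (dS * c) * e₁ + - (P * (dR * c)) * e₂
    expand = solve-∀

  F-cong : ∀ d T {x y : Fin n → ℤ} → (∀ k → x k ≡ y k) → F p d T x ≡ F p d T y
  F-cong d T x≗y = Σ<-cong n (λ j → cong (λ z → + (p ℕ.^ j) * (δ T (shift d j) * z)) (x≗y (shift d j)))

  F-*ˡ : ∀ d T a (x : Fin n → ℤ) → F p d T (λ k → a * x k) ≡ a * F p d T x
  F-*ˡ d T a x = trans (Σ<-cong n (λ j → commute (+ (p ℕ.^ j)) (δ T (shift d j)) a (x (shift d j))))
                       (sym (*-distribˡ-Σ< n a _))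
    where
    commute : ∀ P D a X → P * (D * (a * X)) ≡ a * (P * (D * X))
    commute = solve-∀

  F-neg : ∀ d T (x : Fin n → ℤ) → F p d T (λ k → - x k) ≡ - F p d T x
  F-neg d T x = trans (Σ<-cong n (λ j → pull (+ (p ℕ.^ j)) (δ T (shift d j)) (x (shift d j))))
                      (Σ<-neg n _)
    where
    pull : ∀ P D X → P * (D * - X) ≡ - (P * (D * X))
    pull = solve-∀

  F-sub : ∀ d T (x y : Fin n → ℤ) → F p d T (λ k → x k - y k) ≡ F p d T x - F p d T y
  F-sub d T x y =
    trans (Σ<-cong n (λ j → split (+ (p ℕ.^ j)) (δ T (shift d j)) (x (shift d j)) (y (shift d j))))
          (trans (Σ<-distrib-+ n _ _) (cong (_+_ (F p d T x)) (Σ<-neg n _)))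
    where
    split : ∀ P D X Y → P * (D * (X - Y)) ≡ P * (D * X) + - (P * (D * Y))
    split = solve-∀

  F-split-first : ∀ d T (x : Fin n → ℤ) →
    F p d T x ≡ δ T d * x d
              + + p * Σ< (ℕ.pred n) (λ j → + (p ℕ.^ j) * (δ T (shift d (suc j)) * x (shift d (suc j))))
  F-split-first d T x = begin
    F p d T x                                           ≡⟨ cong (λ m → Σ< m term) (sym (ℕ.suc-pred n)) ⟩
    Σ< (suc (ℕ.pred n)) term                            ≡⟨ Σ<-split-first (ℕ.pred n) term ⟩
    term 0 + Σ< (ℕ.pred n) (λ j → term (suc j))         ≡⟨ cong₂ _+_ first rest ⟩
    δ T d * x d + + p * Σ< (ℕ.pred n) (λ j → + (p ℕ.^ j) * y (suc j)) ∎
    where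
    open ≡-Reasoning
    y term : ℕ → ℤ
    y j = δ T (shift d j) * x (shift d j)
    term j = + (p ℕ.^ j) * y j
    first : term 0 ≡ δ T d * x d
    first = trans (ℤ.*-identityˡ (y 0)) (cong (λ z → δ T z * x z) (shift-zero d))
    rest : Σ< (ℕ.pred n) (λ j → term (suc j)) ≡ + p * Σ< (ℕ.pred n) (λ j → + (p ℕ.^ j) * y (suc j))
    rest = trans (Σ<-cong (ℕ.pred n) (λ j → trans (cong (_* y (suc j)) (ℤ.pos-* p (p ℕ.^ j)))
                                                   (ℤ.*-assoc (+ p) (+ (p ℕ.^ j)) (y (suc j)))))
                 (sym (*-distribˡ-Σ< (ℕ.pred n) (+ p) _))

  module _ {T : Subset n} (adm : AdmissibleSet R S T) where

    admissible⇒δ-step : ∀ i → next i ∉ S → δ T i * δ R i ≡ - δ T (next i)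
    admissible⇒δ-step i i⁺∉S = by-cases (i ∈? R)
      where
      by-cases : Dec (i ∈ R) → δ T i * δ R i ≡ - δ T (next i)
      by-cases (yes i∈R) with proj₂ (adm i i⁺∉S) i∈R
      ... | inj₁ (i∈T , i⁺∈T) = trans (cong₂ _*_ (δ-∈ i∈T) (δ-∈ i∈R)) (cong -_ (sym (δ-∈ i⁺∈T)))
      ... | inj₂ (i∉T , i⁺∉T) = trans (cong₂ _*_ (δ-∉ i∉T) (δ-∈ i∈R)) (cong -_ (sym (δ-∉ i⁺∉T)))
      by-cases (no i∉R) with proj₁ (adm i i⁺∉S) i∉R
      ... | inj₁ (i∈T , i⁺∉T) = trans (cong₂ _*_ (δ-∈ i∈T) (δ-∉ i∉R)) (cong -_ (sym (δ-∉ i⁺∉T)))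
      ... | inj₂ (i∉T , i⁺∈T) = trans (cong₂ _*_ (δ-∉ i∉T) (δ-∉ i∉R)) (cong -_ (sym (δ-∈ i⁺∈T)))

    admissible⇒δ-transfer : ∀ (c : Fin n → ℤ) → (∀ i → i ∈ S → c i ≡ 0ℤ) → ∀ i →
      δ T i * (δ R i * c (next i)) ≡ - (δ T (next i) * (δ S (next i) * c (next i)))
    admissible⇒δ-transfer c c≡0-on-S i = by-cases (next i ∈? S)
      where
      by-cases : Dec (next i ∈ S) →
        δ T i * (δ R i * c (next i)) ≡ - (δ T (next i) * (δ S (next i) * c (next i)))
      by-cases (yes i⁺∈S) rewrite c≡0-on-S (next i) i⁺∈S =
        both-zero (δ T i) (δ R i) (δ T (next i)) (δ S (next i))
        where
        both-zero : ∀ a b a′ b′ → a * (b * 0ℤ) ≡ - (a′ * (b′ * 0ℤ))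
        both-zero = solve-∀
      by-cases (no i⁺∉S) = begin
        δ T i * (δ R i * c (next i))
          ≡⟨ ℤ.*-assoc (δ T i) (δ R i) (c (next i)) ⟨
        (δ T i * δ R i) * c (next i)
          ≡⟨ cong (_* c (next i)) (admissible⇒δ-step i i⁺∉S) ⟩
        - δ T (next i) * c (next i)
          ≡⟨ insert-one (δ T (next i)) (c (next i)) ⟩
        - (δ T (next i) * (1ℤ * c (next i)))
          ≡⟨ cong (λ z → - (δ T (next i) * (z * c (next i)))) (δ-∉ i⁺∉S) ⟨
        - (δ T (next i) * (δ S (next i) * c (next i))) ∎
        where
        open ≡-Reasoning
        insert-one : ∀ a x → - a * x ≡ - (a * (1ℤ * x))
        insert-one = solve-∀

    -- Admissibility turns the j-th summand into h (j+1) − h j, so the sum telescopes to h n − h 0 = 0.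
    F-haSum≡0 : ∀ {s} → s ∈ S → ∀ (c : Fin n → ℤ) → (∀ i → i ∈ S → c i ≡ 0ℤ) → F p s T (haSum c) ≡ 0ℤ
    F-haSum≡0 {s} s∈S c c≡0-on-S = begin
      F p s T (haSum c)                ≡⟨ Σ<-cong n summand ⟩
      Σ< n (λ j → h (suc j) - h j)     ≡⟨ Σ<-telescope n h ⟩
      h n - h 0                        ≡⟨ cong₂ _-_ (h-at (shift-n s)) (h-at (shift-zero s)) ⟩
      0ℤ                               ∎
      where
      open ≡-Reasoning
      h : ℕ → ℤ
      h j = + (p ℕ.^ j) * (δ T (shift s j) * (δ S (shift s j) * c (shift s j)))
      h-at : ∀ {j} → shift s j ≡ s → h j ≡ 0ℤ
      h-at {j} sʲ≡s = trans (cong (λ z → + (p ℕ.^ j) * (δ T (shift s j) * (δ S (shift s j) * z)))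
                                  (trans (cong c sʲ≡s) (c≡0-on-S s s∈S)))
                            (vanish (+ (p ℕ.^ j)) (δ T (shift s j)) (δ S (shift s j)))
        where
        vanish : ∀ P a b → P * (a * (b * 0ℤ)) ≡ 0ℤ
        vanish = solve-∀
      summand : ∀ j → + (p ℕ.^ j) * (δ T (shift s j) * haSum c (shift s j)) ≡ h (suc j) - h j
      summand j = begin
        P * (δ T k * haSum c k)
          ≡⟨ expand P (+ p) (δ T k) (δ S k) (δ R k) (c k) (c (next k)) ⟩
        (+ p * P) * - (δ T k * (δ R k * c (next k))) - h j
          ≡⟨ cong (λ z → (+ p * P) * - z - h j) (admissible⇒δ-transfer c c≡0-on-S k) ⟩
        (+ p * P) * - - (δ T (next k) * (δ S (next k) * c (next k))) - h j
          ≡⟨ cong (λ z → (+ p * P) * z - h j) (ℤ.neg-involutive _) ⟩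
        (+ p * P) * (δ T (next k) * (δ S (next k) * c (next k))) - h j
          ≡⟨ cong₂ (λ P′ z → P′ * (δ T z * (δ S z * c z)) - h j) (sym (ℤ.pos-* p (p ℕ.^ j))) (next-shift s j) ⟩
        h (suc j) - h j ∎
        where
        P = + (p ℕ.^ j)
        k = shift s j
        expand : ∀ P p t s r x x′ →
          P * (t * (- (s * x) + - (p * (r * x′)))) ≡ (p * P) * - (t * (r * x′)) - P * (t * (s * x))
        expand = solve-∀

  module _ (T : Fin n → Subset n) (x : Fin n → ℤ) where

    F≡0⇒𝕂-pCone : (∀ s → s ∈ S → F p s (T s) x ≡ 0ℤ) → 𝕂 (pCone p S T) x
    F≡0⇒𝕂-pCone F≡0 = (λ s s∈S → ℤ.≤-reflexive (F≡0 s s∈S))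
                    , (λ s s∈S → ℤ.≤-reflexive (trans (F-neg s (T s) x) (cong -_ (F≡0 s s∈S))))

    𝕂-pCone⇒F≡0 : 𝕂 (pCone p S T) x → ∀ s → s ∈ S → F p s (T s) x ≡ 0ℤ
    𝕂-pCone⇒F≡0 (x∈C , -x∈C) s s∈S = ℤ.≤-antisym (x∈C s s∈S) 0≤F
      where
      0≤F : 0ℤ ℤ.≤ F p s (T s) x
      0≤F = subst (0ℤ ℤ.≤_) (ℤ.neg-involutive _)
                  (ℤ.neg-mono-≤ (subst (ℤ._≤ 0ℤ) (F-neg s (T s) x) (-x∈C s s∈S)))

    𝕂S⇒F≡0 : Admissible R S T → 𝕂S p R S x → ∀ s → s ∈ S → F p s (T s) x ≡ 0ℤ
    𝕂S⇒F≡0 adm (m , 1≤m , c , c≡0-on-S , mx≡Σ) s s∈S =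
      ℤ.*-cancelˡ-≡ (+ m) _ _ {{ℕ.>-nonZero 1≤m}} (begin
        + m * F p s (T s) x            ≡⟨ F-*ˡ s (T s) (+ m) x ⟨
        F p s (T s) (λ k → + m * x k)  ≡⟨ F-cong s (T s) (λ k → trans (mx≡Σ k) (ΣFin-ha c k)) ⟩
        F p s (T s) (haSum c)          ≡⟨ F-haSum≡0 (adm s s∈S) s∈S c c≡0-on-S ⟩
        0ℤ                             ≡⟨ ℤ.*-zeroʳ (+ m) ⟨
        + m * 0ℤ                       ∎)
      where open ≡-Reasoning

  -- Solving for the coefficients off S

  𝟙∉S : Fin n → ℤ
  𝟙∉S k with k ∈? S
  ... | yes _ = 0ℤ
  ... | no  _ = 1ℤ

  𝟙∉S-∈ : ∀ {k} → k ∈ S → 𝟙∉S k ≡ 0ℤ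
  𝟙∉S-∈ {k} k∈S with k ∈? S
  ... | yes _   = refl
  ... | no  k∉S = contradiction k∈S k∉S

  𝟙∉S-∉ : ∀ {k} → k ∉ S → 𝟙∉S k ≡ 1ℤ
  𝟙∉S-∉ {k} k∉S with k ∈? S
  ... | yes k∈S = contradiction k∈S k∉S
  ... | no  _   = refl

  -- weight j k is the coefficient of v (k + j) in (Nʲ (𝟙∉S · v)) k,
  -- where (N v) k = 𝟙∉S k · δ_R(k) · v (k + 1).
  weight : ℕ → Fin n → ℤ
  weight zero    k = 𝟙∉S k
  weight (suc j) k = 𝟙∉S k * (δ R k * weight j (next k))

  weight-∈S : ∀ {k} → k ∈ S → ∀ j → weight j k ≡ 0ℤ
  weight-∈S k∈S zero    = 𝟙∉S-∈ k∈S
  weight-∈S {k} k∈S (suc j) =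
    trans (cong (_* (δ R k * weight j (next k))) (𝟙∉S-∈ k∈S)) (ℤ.*-zeroˡ (δ R k * weight j (next k)))

  weight-through-S : ∀ j k i → i ℕ.≤ j → shift k i ∈ S → weight j k ≡ 0ℤ
  weight-through-S j       k zero    _         kᵢ∈S = weight-∈S (subst (_∈ S) (shift-zero k) kᵢ∈S) j
  weight-through-S (suc j) k (suc i) (s≤s i≤j) kᵢ∈S =
    trans (cong (λ z → 𝟙∉S k * (δ R k * z))
                (weight-through-S j (next k) i i≤j (subst (_∈ S) (sym (shift-next k i)) kᵢ∈S)))
          (vanish (𝟙∉S k) (δ R k))
    where
    vanish : ∀ a b → a * (b * 0ℤ) ≡ 0ℤ
    vanish = solve-∀

  weight-n≡0 : ∀ {s} → s ∈ S → ∀ k → weight n k ≡ 0ℤ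
  weight-n≡0 {s} s∈S k with shift-reaches k s
  ... | i , i<n , kᵢ≡s = weight-through-S n k i (ℕ.<⇒≤ i<n) (subst (_∈ S) (sym kᵢ≡s) s∈S)

  weight²≡1 : (∀ k → k ∉ S) → ∀ j k → weight j k * weight j k ≡ 1ℤ
  weight²≡1 S≡∅ zero    k = cong (λ z → z * z) (𝟙∉S-∉ (S≡∅ k))
  weight²≡1 S≡∅ (suc j) k = begin
    (a * (d * w)) * (a * (d * w))  ≡⟨ regroup a d w ⟩
    (a * a) * ((d * d) * (w * w))  ≡⟨ cong₂ (λ x y → x * (y * (w * w))) a²≡1 (δ*δ≡1 R k) ⟩
    1ℤ * (1ℤ * (w * w))            ≡⟨ cong (λ z → 1ℤ * (1ℤ * z)) (weight²≡1 S≡∅ j (next k)) ⟩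
    1ℤ                             ∎
    where
    open ≡-Reasoning
    a = 𝟙∉S k
    d = δ R k
    w = weight j (next k)
    a²≡1 : a * a ≡ 1ℤ
    a²≡1 = cong (λ z → z * z) (𝟙∉S-∉ (S≡∅ k))
    regroup : ∀ a d w → (a * (d * w)) * (a * (d * w)) ≡ (a * a) * ((d * d) * (w * w))
    regroup = solve-∀

  -- − Σ_{j<n} (−pN)ʲ (𝟙∉S · v): off S, haSum c = −(1 + pN) c, and the geometric series
  -- inverts 1 + pN up to the error (−pN)ⁿ.
  preimage : (Fin n → ℤ) → Fin n → ℤ
  preimage v k = - Σ< n (λ j → (- + p) ℤ.^ j * (weight j k * v (shift k j)))

  preimage-∈S : ∀ v {k} → k ∈ S → preimage v k ≡ 0ℤ
  preimage-∈S v {k} k∈S =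
    cong -_ (Σ<-zero n (λ j → trans (cong (λ z → (- + p) ℤ.^ j * (z * v (shift k j))) (weight-∈S k∈S j))
                                    (ℤ.*-zeroʳ ((- + p) ℤ.^ j))))

  haSum-preimage : ∀ v {k} → k ∉ S → haSum (preimage v) k ≡ v k - (- + p) ℤ.^ n * (weight n k * v k)
  haSum-preimage v {k} k∉S = begin
    haSum (preimage v) k
      ≡⟨ cong₂ (λ d z → - (d * preimage v k) + - z) (δ-∉ k∉S) next-part ⟩
    - (1ℤ * - Σ< n f) + - Σ< n (f ∘ suc)
      ≡⟨ regroup (Σ< n f) (Σ< n (f ∘ suc)) ⟩
    - (Σ< n (f ∘ suc) + - Σ< n f)
      ≡⟨ cong -_ (trans (Σ<-distrib-+ n (f ∘ suc) (-_ ∘ f)) (cong (_+_ (Σ< n (f ∘ suc))) (Σ<-neg n f))) ⟨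
    - Σ< n (λ j → f (suc j) - f j)
      ≡⟨ cong -_ (Σ<-telescope n f) ⟩
    - (f n - f 0)
      ≡⟨ cong₂ (λ a b → - (a - b)) f-n f-0 ⟩
    - ((- + p) ℤ.^ n * (weight n k * v k) - v k)
      ≡⟨ swap-sub ((- + p) ℤ.^ n * (weight n k * v k)) (v k) ⟩
    v k - (- + p) ℤ.^ n * (weight n k * v k) ∎
    where
    open ≡-Reasoning
    f : ℕ → ℤ
    f j = (- + p) ℤ.^ j * (weight j k * v (shift k j))
    regroup : ∀ a b → - (1ℤ * - a) + - b ≡ - (b + - a)
    regroup = solve-∀
    swap-sub : ∀ a b → - (a - b) ≡ b - a
    swap-sub = solve-∀
    f-n : f n ≡ (- + p) ℤ.^ n * (weight n k * v k)
    f-n = cong (λ z → (- + p) ℤ.^ n * (weight n k * v z)) (shift-n k)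
    f-0 : f 0 ≡ v k
    f-0 = trans (cong₂ (λ a z → 1ℤ * (a * v z)) (𝟙∉S-∉ k∉S) (shift-zero k)) (units (v k))
      where
      units : ∀ x → 1ℤ * (1ℤ * x) ≡ x
      units = solve-∀
    summand : ∀ j → (+ p * δ R k) * ((- + p) ℤ.^ j * (weight j (next k) * v (shift (next k) j))) ≡ - f (suc j)
    summand j = begin
      (+ p * δ R k) * (A * (W * v (shift (next k) j)))
        ≡⟨ regroup′ (+ p) (δ R k) A W (v (shift (next k) j)) ⟩
      - ((- + p * A) * ((1ℤ * (δ R k * W)) * v (shift (next k) j)))
        ≡⟨ cong₂ (λ a z → - ((- + p * A) * ((a * (δ R k * W)) * v z))) (sym (𝟙∉S-∉ k∉S)) (shift-next k j) ⟩
      - f (suc j) ∎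
      where
      A = (- + p) ℤ.^ j
      W = weight j (next k)
      regroup′ : ∀ P d A W V → (P * d) * (A * (W * V)) ≡ - ((- P * A) * ((1ℤ * (d * W)) * V))
      regroup′ = solve-∀
    next-part : + p * (δ R k * preimage v (next k)) ≡ Σ< n (f ∘ suc)
    next-part = begin
      + p * (δ R k * - Σ< n g)            ≡⟨ pull (+ p) (δ R k) (Σ< n g) ⟩
      - ((+ p * δ R k) * Σ< n g)          ≡⟨ cong -_ (*-distribˡ-Σ< n (+ p * δ R k) g) ⟩
      - Σ< n (λ j → (+ p * δ R k) * g j)  ≡⟨ cong -_ (Σ<-cong n summand) ⟩
      - Σ< n (λ j → - f (suc j))          ≡⟨ cong -_ (Σ<-neg n (f ∘ suc)) ⟩
      - - Σ< n (f ∘ suc)                  ≡⟨ ℤ.neg-involutive _ ⟩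
      Σ< n (f ∘ suc)                      ∎
      where
      g : ℕ → ℤ
      g j = (- + p) ℤ.^ j * (weight j (next k) * v (shift (next k) j))
      pull : ∀ P d s → P * (d * - s) ≡ - ((P * d) * s)
      pull = solve-∀

  -- p-adic descent

  module _ (1<p : 1 ℕ.< p) where

    private instance
      p≢0 : NonZero p
      p≢0 = ℕ.>-nonZero (ℕ.<-trans ℕ.z<s 1<p)

    module _ (T : Fin n → Subset n) where

      Residual : (Fin n → ℤ) → Set
      Residual r = (∀ k → k ∉ S → r k ≡ 0ℤ) × (∀ t → t ∈ S → F p t (T t) r ≡ 0ℤ)

      Residual⇒p∣ : ∀ {r} → Residual r → ∀ k → ∃[ q ] r k ≡ + p * q
      Residual⇒p∣ {r} (r≡0-off-S , F≡0) k = by-cases (k ∈? S)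
        where
        by-cases : Dec (k ∈ S) → ∃[ q ] r k ≡ + p * q
        by-cases (no k∉S)  = 0ℤ , trans (r≡0-off-S k k∉S) (sym (ℤ.*-zeroʳ (+ p)))
        by-cases (yes k∈S) = - (D * X) , (begin
          r k                                ≡⟨ ℤ.*-identityˡ (r k) ⟨
          1ℤ * r k                           ≡⟨ cong (_* r k) (δ*δ≡1 (T k) k) ⟨
          (D * D) * r k                      ≡⟨ expand D (r k) (+ p) X ⟩
          D * (D * r k + + p * X) - D * (+ p * X)
            ≡⟨ cong (λ z → D * z - D * (+ p * X)) (trans (sym (F-split-first k (T k) r)) (F≡0 k k∈S)) ⟩
          D * 0ℤ - D * (+ p * X)             ≡⟨ collect D (+ p) X ⟩
          + p * - (D * X)                    ∎)
          where
          open ≡-Reasoning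
          D = δ (T k) k
          X = Σ< (ℕ.pred n) (λ j → + (p ℕ.^ j) * (δ (T k) (shift k (suc j)) * r (shift k (suc j))))
          expand : ∀ D r P X → (D * D) * r ≡ D * (D * r + P * X) - D * (P * X)
          expand = solve-∀
          collect : ∀ D P X → D * 0ℤ - D * (P * X) ≡ P * - (D * X)
          collect = solve-∀

      Residual-quotient : ∀ {r r′} → (∀ k → r k ≡ + p * r′ k) → Residual r → Residual r′
      Residual-quotient {r} {r′} r≡pr′ (r≡0-off-S , F≡0) =
          (λ k k∉S → ℤ.*-cancelˡ-≡ (+ p) (r′ k) 0ℤ
                       (trans (sym (r≡pr′ k)) (trans (r≡0-off-S k k∉S) (sym (ℤ.*-zeroʳ (+ p))))))
        , (λ t t∈S → ℤ.*-cancelˡ-≡ (+ p) (F p t (T t) r′) 0ℤ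
                       (trans (sym (F-*ˡ t (T t) (+ p) r′))
                       (trans (F-cong t (T t) (sym ∘ r≡pr′))
                       (trans (F≡0 t t∈S) (sym (ℤ.*-zeroʳ (+ p)))))))

      Residual⇒p^K∣ : ∀ K {r} → Residual r → ∀ k → + (p ℕ.^ K) ∣ r k
      Residual⇒p^K∣ zero    {r} _   k = ℕ.1∣ ℤ.∣ r k ∣
      Residual⇒p^K∣ (suc K) {r} res k =
        subst₂ _∣_ (sym (ℤ.pos-* p (p ℕ.^ K))) (sym (r≡pr′ k))
               (ℤ∣.*-monoʳ-∣ (+ p) (Residual⇒p^K∣ K (Residual-quotient r≡pr′ res) k))
        where
        r′ : Fin n → ℤ
        r′ k = proj₁ (Residual⇒p∣ res k)
        r≡pr′ : ∀ k → r k ≡ + p * r′ k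
        r≡pr′ k = proj₂ (Residual⇒p∣ res k)

      Residual⇒≡0 : ∀ {r} → Residual r → ∀ k → r k ≡ 0ℤ
      Residual⇒≡0 {r} res k = divisible-by-all-powers⇒0 1<p (r k) (λ K → Residual⇒p^K∣ K res k)

      F≡0⇒𝕂S : Admissible R S T → ∀ {s} → s ∈ S → ∀ {x} →
               (∀ t → t ∈ S → F p t (T t) x ≡ 0ℤ) → 𝕂S p R S x
      F≡0⇒𝕂S adm {s} s∈S {x} F≡0 =
        1 , s≤s z≤n , preimage x , (λ i → preimage-∈S x) , λ k → begin
          + 1 * x k                                    ≡⟨ ℤ.*-identityˡ (x k) ⟩
          x k                                          ≡⟨ ℤ.i-j≡0⇒i≡j _ _ (Residual⇒≡0 residual k) ⟩
          haSum (preimage x) k                         ≡⟨ ΣFin-ha (preimage x) k ⟨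
          ΣFin (λ i → preimage x i * ha p R S i k)     ∎
        where
        open ≡-Reasoning
        residual : Residual (λ k → x k - haSum (preimage x) k)
        residual =
            (λ k k∉S → trans (cong (_-_ (x k)) (haSum-preimage x k∉S))
                             (trans (cong (λ w → x k - (x k - (- + p) ℤ.^ n * (w * x k))) (weight-n≡0 s∈S k))
                                    (cancel (x k) ((- + p) ℤ.^ n))))
          , (λ t t∈S → trans (F-sub t (T t) x (haSum (preimage x)))
                             (cong₂ _-_ (F≡0 t t∈S)
                                        (F-haSum≡0 (adm t t∈S) t∈S (preimage x) (λ i → preimage-∈S x))))
          where
          cancel : ∀ y a → y - (y - a * (0ℤ * y)) ≡ 0ℤ
          cancel = solve-∀

    -- With a = (−p)ⁿ and w = weight n k = ±1, the preimage of − (1 + a w) x is mapped to (a² − 1) x.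
    S≡∅⇒𝕂S : (∀ k → k ∉ S) → ∀ x → 𝕂S p R S x
    S≡∅⇒𝕂S S≡∅ x = m , 1≤m , preimage v , (λ i i∈S → contradiction i∈S (S≡∅ i)) , λ k → sym (begin
      ΣFin (λ i → preimage v i * ha p R S i k)          ≡⟨ ΣFin-ha (preimage v) k ⟩
      haSum (preimage v) k                              ≡⟨ haSum-preimage v (S≡∅ k) ⟩
      v k - a * (weight n k * v k)                      ≡⟨ expand a (weight n k) (x k) ⟩
      ((a * a) * (weight n k * weight n k) - 1ℤ) * x k
        ≡⟨ cong₂ (λ a² w² → (a² * w² - 1ℤ) * x k) ([-p]^j*[-p]^j≡p^j*p^j p n) (weight²≡1 S≡∅ n k) ⟩
      (+ (q ℕ.* q) * 1ℤ - 1ℤ) * x k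
        ≡⟨ cong (λ z → (z - 1ℤ) * x k) (ℤ.*-identityʳ (+ (q ℕ.* q))) ⟩
      (+ (q ℕ.* q) - 1ℤ) * x k
        ≡⟨ cong (_* x k) (trans (ℤ.m-n≡m⊖n (q ℕ.* q) 1) (ℤ.⊖-≥ (ℕ.<⇒≤ 1<q²))) ⟩
      + m * x k                                         ∎)
      where
      open ≡-Reasoning
      a : ℤ
      a = (- + p) ℤ.^ n
      q m : ℕ
      q = p ℕ.^ n
      m = q ℕ.* q ℕ.∸ 1
      v : Fin n → ℤ
      v k = - ((1ℤ + a * weight n k) * x k)
      1<q : 1 ℕ.< q
      1<q = ℕ.≤-<-trans (ℕ.>-nonZero⁻¹ n) (n<p^n 1<p n)
      1<q² : 1 ℕ.< q ℕ.* q
      1<q² = ℕ.<-≤-trans 1<q (ℕ.m≤m*n q q {{ℕ.>-nonZero (ℕ.<-trans ℕ.z<s 1<q)}})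
      1≤m : 1 ℕ.≤ m
      1≤m = ℕ.m<n⇒0<n∸m 1<q²
      expand : ∀ a w x →
        - ((1ℤ + a * w) * x) - a * (w * - ((1ℤ + a * w) * x)) ≡ ((a * a) * (w * w) - 1ℤ) * x
      expand = solve-∀

proposition5p6p5 : (n : ℕ) .{{_ : NonZero n}} (p : ℕ) → Prime p →
    (R S : Subset n) (T : Fin n → Subset n) → Admissible R S T →
    (x : Fin n → ℤ) →
    ((𝕂 (pCone p S T) x → 𝕂S p R S x) × (𝕂S p R S x → 𝕂 (pCone p S T) x))
proposition5p6p5 n p p-prime R S T adm x = 𝕂⇒𝕂S , F≡0⇒𝕂-pCone T x ∘ 𝕂S⇒F≡0 T x adm
  where
  open Cones p R S
  1<p : 1 ℕ.< p
  1<p = ℕ.nonTrivial⇒n>1 p {{prime⇒nonTrivial p-prime}}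
  𝕂⇒𝕂S : 𝕂 (pCone p S T) x → 𝕂S p R S x
  𝕂⇒𝕂S x∈𝕂 with nonempty? S
  ... | yes (s , s∈S) = F≡0⇒𝕂S 1<p T adm s∈S (𝕂-pCone⇒F≡0 T x x∈𝕂)
  ... | no  S≢∅       = S≡∅⇒𝕂S 1<p (λ k k∈S → S≢∅ (k , k∈S)) x
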